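{- For all integers $k,\ell\geq 0$, $R(k,\ell)\leq k+\ell$.
   Context: $\Gamma_n$ is the complete binary tree of height $n$ (rooted; every non-leaf vertex has two children; every root-to-leaf path has $n$ edges; $\Gamma_0$ is a single vertex). A path in a rooted tree $T$ is descending if it is contained in a path of $T$ starting at the root. For vertices $p,q$ of a tree $T$, $pTq$ is the unique $pq$-path in $T$. If $T'$ is a subdivision of a tree, its original vertices are those coming from the vertices of that tree (the rest are subdivision vertices). Given a colouring of the vertices of $T=\Gamma_n$ with colours red and blue, $T$ contains a red subdivision of $\Gamma_k$ if $T$ has a subgraph $T'$ that is a subdivision of $\Gamma_k$ (rooted at the image of the root of $\Gamma_k$) such that all original vertices of $T'$ are red and for all $a,b\in V(T')$ with $b$ a descendant of $a$ in $T'$, the path $aTb$ is descending; a blue subdivision of $\Gamma_\ell$ is defined analogously. $R(k,\ell)$ is the minimum integer $n$ such that every red/blue colouring of the vertices of $\Gamma_n$ contains a red subdivision of $\Gamma_k$ or a blue subdivision of $\Gamma_\ell$. -}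

module Defs where

open import Data.Bool using (Bool; true; false; not)
open import Data.List using (List; []; _∷_; _++_; [_]; length)
open import Data.Nat using (ℕ; _≤_; _<_)
open import Data.Nat.Properties using (<⇒≤)
open import Data.Product using (Σ; ∃; ∃-syntax; _×_; _,_; proj₁)
open import Data.Sum using (_⊎_)
open import Relation.Binary.PropositionalEquality using (_≡_)

-- Vertices of the complete binary tree Γ n: addresses = sequences of
-- left/right moves from the root (first move first), of length ≤ n.
-- The root is [], the children of w (when length w < n) are
-- w ++ [ false ] and w ++ [ true ].
Vertex : ℕ → Set
Vertex n = Σ (List Bool) (λ w → length w ≤ n)

addr : ∀ {n} → Vertex n → List Bool
addr = proj₁

data Colour : Set where
  red blue : Colour

Colouring : ℕ → Set
Colouring n = Vertex n → Colour

-- u' is a strict descendant of u in Γ n lying below the child u ++ [ b ] of u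
-- (the path u Γ u' is then descending and starts with the edge to u ++ [ b ]).
DescVia : List Bool → Bool → List Bool → Set
DescVia u b u' = ∃[ s ] (u' ≡ u ++ (b ∷ s))

-- A subdivision T' of Γ k inside Γ n whose original vertices all have colour c
-- and in which every T'-ancestor/descendant pair is joined by a descending
-- path of Γ n.  Such a subdivision is determined by the map f sending each
-- vertex of Γ k to the corresponding original vertex: for every non-leaf w
-- of Γ k with children w ++ [false], w ++ [true], the images of the children
-- are strict descendants of f w lying below the two distinct children of
-- f w (so the subdivided edges are descending paths of Γ n meeting only at f w).
MonoSubdivision : ∀ {n} → Colouring n → Colour → ℕ → Set
MonoSubdivision {n} χ c k =
  Σ (Vertex k → Vertex n) λ f →
    (∀ v → χ (f v) ≡ c) ×
    (∀ (w : List Bool) (lt : length w < k)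
       (l : length (w ++ [ false ]) ≤ k) (r : length (w ++ [ true ]) ≤ k) →
       ∃[ b ] (DescVia (addr (f (w , <⇒≤ lt))) b (addr (f (w ++ [ false ] , l)))
             × DescVia (addr (f (w , <⇒≤ lt))) (not b) (addr (f (w ++ [ true ] , r)))))

Arrows : ℕ → ℕ → ℕ → Set
Arrows n k ℓ = (χ : Colouring n) → MonoSubdivision χ red k ⊎ MonoSubdivision χ blue ℓ

module Submission where

open import Defs
open import Data.Bool using (Bool; true; false; not)
open import Data.Empty using (⊥-elim)
open import Data.List using (List; []; _∷_; _++_; [_]; length)
open import Data.List.Properties using (++-assoc; ++-identityʳ)
open import Data.Nat using (ℕ; zero; suc; _+_; _≤_; _<_; _≤?_; s≤s; z≤n)
open import Data.Nat.Properties using (≤-refl; ≤-irrelevant; +-suc)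
open import Data.Product using (∃-syntax; Σ-syntax; _×_; _,_)
open import Data.Sum using (_⊎_; inj₁; inj₂; swap)
open import Relation.Binary.PropositionalEquality using (_≡_; sym; trans; subst; cong)
open import Relation.Nullary using (yes; no)

-- Induction on k + ℓ, working at an arbitrary
-- vertex v with d = k + ℓ levels available below it.  If v is red and k > 0,
-- apply induction (k - 1, ℓ) at both children: either both children carry a
-- red Γ (k-1), which together with v form a red Γ k, or one child carries a
-- blue Γ ℓ, which is then also a blue Γ ℓ below v.  The blue case is symmetric,
-- and k = 0 (resp. ℓ = 0) is witnessed by v alone.

module Certificates (χ : List Bool → Colour) where

  -- Embedding c k v d: a colour-c subdivision of Γ k lying weakly below v,
  -- all of whose original vertices are at most d levels below v.
  data Embedding (c : Colour) : ℕ → List Bool → ℕ → Set where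
    leaf   : ∀ {v d} → χ v ≡ c → Embedding c 0 v d
    branch : ∀ {k v d} (b : Bool) → χ v ≡ c →
             Embedding c k (v ++ [ b ]) d → Embedding c k (v ++ [ not b ]) d →
             Embedding c (suc k) v (suc d)
    skip   : ∀ {k v d} (b : Bool) →
             Embedding c k (v ++ [ b ]) d → Embedding c k v (suc d)

  branchOrDescend : ∀ {c c' k ℓ v d} → χ v ≡ c →
    (∀ b → Embedding c k (v ++ [ b ]) d ⊎ Embedding c' ℓ (v ++ [ b ]) d) →
    Embedding c (suc k) v (suc d) ⊎ Embedding c' ℓ v (suc d)
  branchOrDescend χv children with children false | children true
  ... | inj₁ left | inj₁ right = inj₁ (branch false χv left right)
  ... | inj₂ left | _          = inj₂ (skip false left)
  ... | inj₁ _    | inj₂ right = inj₂ (skip true right)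

  ramsey : ∀ k ℓ v → Embedding red k v (k + ℓ) ⊎ Embedding blue ℓ v (k + ℓ)
  ramsey k ℓ v with χ v in χv
  ramsey zero    ℓ       v | red  = inj₁ (leaf χv)
  ramsey (suc k) ℓ       v | red  =
    branchOrDescend χv (λ b → ramsey k ℓ (v ++ [ b ]))
  ramsey k       zero    v | blue = inj₂ (leaf χv)
  -- (k + suc ℓ = suc (k + ℓ) only propositionally, hence the transport.)
  ramsey k       (suc ℓ) v | blue =
    subst (λ d → Embedding red k v d ⊎ Embedding blue (suc ℓ) v d) (sym (+-suc k ℓ))
      (swap (branchOrDescend χv (λ b → swap (ramsey k ℓ (v ++ [ b ])))))

  -- The original vertex that an embedding assigns to the vertex w of Γ k
  -- (addresses longer than k are sent to the image of a leaf).
  image : ∀ {c k v d} → Embedding c k v d → List Bool → List Bool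
  image {v = v} (leaf _)           w           = v
  image {v = v} (branch _ _ _ _)   []          = v
  image         (branch _ _ e₀ _)  (false ∷ w) = image e₀ w
  image         (branch _ _ _ e₁)  (true ∷ w)  = image e₁ w
  image         (skip _ e)         w           = image e w

  belowChild : ∀ (v : List Bool) b t {u} → u ≡ (v ++ [ b ]) ++ t → u ≡ v ++ (b ∷ t)
  belowChild v b t eq = trans eq (++-assoc v [ b ] t)

  image-extends : ∀ {c k v d} (e : Embedding c k v d) w →
                  Σ[ t ∈ List Bool ] (image e w ≡ v ++ t × length t ≤ d)
  image-extends {v = v} (leaf _)         w  = [] , sym (++-identityʳ v) , z≤n
  image-extends {v = v} (branch _ _ _ _) [] = [] , sym (++-identityʳ v) , z≤n
  image-extends {v = v} (branch b _ e₀ _) (false ∷ w) with image-extends e₀ w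
  ... | t , eq , len = b ∷ t , belowChild v b t eq , s≤s len
  image-extends {v = v} (branch b _ _ e₁) (true ∷ w) with image-extends e₁ w
  ... | t , eq , len = not b ∷ t , belowChild v (not b) t eq , s≤s len
  image-extends {v = v} (skip b e) w with image-extends e w
  ... | t , eq , len = b ∷ t , belowChild v b t eq , s≤s len

  image-colour : ∀ {c k v d} (e : Embedding c k v d) w → χ (image e w) ≡ c
  image-colour (leaf χv)          w           = χv
  image-colour (branch _ χv _ _)  []          = χv
  image-colour (branch _ _ e₀ _)  (false ∷ w) = image-colour e₀ w
  image-colour (branch _ _ _ e₁)  (true ∷ w)  = image-colour e₁ w
  image-colour (skip _ e)         w           = image-colour e w

  image-branches : ∀ {c k v d} (e : Embedding c k v d) w → length w < k →
    ∃[ b ] (DescVia (image e w) b (image e (w ++ [ false ]))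
          × DescVia (image e w) (not b) (image e (w ++ [ true ])))
  image-branches {v = v} (branch b _ e₀ e₁) [] _
    with image-extends e₀ [] | image-extends e₁ []
  ... | t₀ , eq₀ , _ | t₁ , eq₁ , _ =
    b , (t₀ , belowChild v b t₀ eq₀) , (t₁ , belowChild v (not b) t₁ eq₁)
  image-branches (branch _ _ e₀ _) (false ∷ w) (s≤s lt) = image-branches e₀ w lt
  image-branches (branch _ _ _ e₁) (true ∷ w)  (s≤s lt) = image-branches e₁ w lt
  image-branches (skip _ e)        w           lt       = image-branches e w lt

module Realisation (n : ℕ) (χ : Colouring n) where

  -- Extension of χ to all addresses; the colour outside Γ n is irrelevant.
  extend : List Bool → Colour
  extend w with length w ≤? n
  ... | yes inside = χ (w , inside)
  ... | no  _      = red

  -- Inside Γ n the extension is χ itself (proofs of ≤ are irrelevant).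
  extend-agrees : ∀ w (inside : length w ≤ n) → extend w ≡ χ (w , inside)
  extend-agrees w inside with length w ≤? n
  ... | yes inside′ = cong (λ p → χ (w , p)) (≤-irrelevant inside′ inside)
  ... | no  outside = ⊥-elim (outside inside)

  open Certificates extend

  realise : ∀ {c k} → Embedding c k [] n → MonoSubdivision χ c k
  realise {c} {k} e = f , colour , (λ w lt _ _ → image-branches e w lt)
    where
    inside : ∀ w → length (image e w) ≤ n
    inside w with image-extends e w
    ... | t , eq , len = subst (λ u → length u ≤ n) (sym eq) len

    f : Vertex k → Vertex n
    f (w , _) = image e w , inside w

    colour : ∀ x → χ (f x) ≡ c
    colour (w , _) = trans (sym (extend-agrees (image e w) (inside w))) (image-colour e w)

lemma3p2 : ∀ (k ℓ : ℕ) → ∃[ n ] (n ≤ k + ℓ × Arrows n k ℓ)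
lemma3p2 k ℓ = k + ℓ , ≤-refl , arrows
  where
  open Realisation (k + ℓ)

  arrows : Arrows (k + ℓ) k ℓ
  arrows χ with Certificates.ramsey (extend χ) k ℓ []
  ... | inj₁ redTree  = inj₁ (realise χ redTree)
  ... | inj₂ blueTree = inj₂ (realise χ blueTree)
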